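{- Let $U$ be a finite set, $\mathcal{F}\subseteq 2^U$ a closure difference and $R$ a commutative ring with unit. Then, as operators on functions $\mathcal{F}\to R$: (1) $\sigma\zeta\sigma=\mu$ and $\sigma\mu\sigma=\zeta$; (2) $\mu\zeta=\zeta\mu=\mathrm{id}$; (3) $\zeta(A\otimes_c B)=(\zeta A)\cdot(\zeta B)$ for all tables $A,B\colon\mathcal{F}\to R$.
   Context: $\uparrow(\mathcal{G})=\{S\subseteq U:\exists T\in\mathcal{G},\ T\subseteq S\}$; $\mathcal{F}$ is a closure difference if $\mathcal{F}=\uparrow(\mathcal{F}_+)\setminus\uparrow(\mathcal{F}_-)$ for some families $\mathcal{F}_+,\mathcal{F}_-$. For $A\colon\mathcal{F}\to R$ and $S\in\mathcal{F}$: Zeta transform $(\zeta A)(S)=\sum_{T\in\mathcal{F},T\subseteq S}A(T)$; Möbius transform $(\mu A)(S)=\sum_{T\in\mathcal{F},T\subseteq S}(-1)^{|S\setminus T|}A(T)$; odd-negation transform $(\sigma A)(S)=(-1)^{|S|}A(S)$. Cover product $(A\otimes_c B)(S)=\sum_{T_1,T_2\in\mathcal{F}: T_1\cup T_2=S}A(T_1)B(T_2)$; $(A\cdot B)(S)=A(S)B(S)$ is pointwise multiplication. -}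

module Defs where

open import Level using (Level)
open import Data.Nat using (ℕ; zero; suc)
open import Data.Bool using (Bool; true; false; _∧_; not; if_then_else_)
import Data.Bool as B
open import Data.List using (List; []; _∷_; _++_; map; foldr)
open import Data.Bool.ListAction using (any)
open import Data.Vec using ([]; _∷_)
open import Data.Vec.Properties using (≡-dec)
open import Data.Fin.Subset using (Subset; _∪_; _─_; ∣_∣; outside; inside)
open import Data.Fin.Subset.Properties using (_⊆?_)
open import Relation.Nullary.Decidable using (isYes)
open import Algebra.Bundles using (CommutativeRing)

allSubsets : (n : ℕ) → List (Subset n)
allSubsets zero = [] ∷ []
allSubsets (suc n) = map (outside ∷_) (allSubsets n) ++ map (inside ∷_) (allSubsets n)

inUp : {n : ℕ} → List (Subset n) → Subset n → Bool
inUp G S = any (λ T → isYes (T ⊆? S)) G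

-- Membership in the closure difference F = ↑(F₊) \ ↑(F₋).
inCD : {n : ℕ} → List (Subset n) → List (Subset n) → Subset n → Bool
inCD F₊ F₋ S = inUp F₊ S ∧ not (inUp F₋ S)

subsetEq : {n : ℕ} → Subset n → Subset n → Bool
subsetEq S T = isYes (≡-dec B._≟_ S T)

module Transforms {c ℓ : Level} (R : CommutativeRing c ℓ) where
  open CommutativeRing R

  sgn : ℕ → Carrier
  sgn zero = 1#
  sgn (suc k) = - (sgn k)

  sumWhere : {n : ℕ} → (Subset n → Bool) → (Subset n → Carrier) → Carrier
  sumWhere {n} p f = foldr (λ T acc → if p T then f T + acc else acc) 0# (allSubsets n)

  -- A table F → R is represented by a function Subset n → Carrier; only
  -- its values on members of F are ever used.
  module OnFamily {n : ℕ} (inF : Subset n → Bool) where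
    Table : Set c
    Table = Subset n → Carrier

    ζ : Table → Table
    ζ A S = sumWhere (λ T → inF T ∧ isYes (T ⊆? S)) A

    μ : Table → Table
    μ A S = sumWhere (λ T → inF T ∧ isYes (T ⊆? S)) (λ T → sgn ∣ S ─ T ∣ * A T)

    σ : Table → Table
    σ A S = sgn ∣ S ∣ * A S

    cover : Table → Table → Table
    cover A B S = sumWhere inF (λ T₁ → sumWhere (λ T₂ → inF T₂ ∧ subsetEq (T₁ ∪ T₂) S) (λ T₂ → A T₁ * B T₂))

    pointwise : Table → Table → Table
    pointwise A B S = A S * B S

{-# OPTIONS --safe #-}
module Submission where

-- A closure difference F = ↑F₊ ∖ ↑F₋ is convex: if X ⊆ T ⊆ S with X, S ∈ F
-- then T ∈ F.  For part (1) the signs combine since |S| = |S ∖ T| + |T|.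
-- For μζ = id, exchanging the two sums leaves, for X ⊆ S in F, the sum of
-- (-1)^|S ∖ T| over the interval X ⊆ T ⊆ S, where convexity lets T range over
-- all sets; this alternating sum is [X = S].  Conjugating by σ turns μζ = id
-- into ζμ = id.  For the cover product, convexity makes T₁ ∪ T₂ ∈ F automatic
-- when T₁, T₂ ∈ F lie below S, so ζ(A ⊗ B)(S) splits into a product of sums.

open import Defs
open import Level using (Level)
open import Data.Nat using (ℕ; zero; suc)
import Data.Nat as ℕ
open import Data.Nat.Properties using (+-suc)
open import Data.Bool using (Bool; true; false; _∧_; not; if_then_else_)
import Data.Bool as Bool
open import Data.Bool.Properties using (∧-zeroʳ; ∧-conicalʳ)
open import Data.List using (List; []; _∷_; _++_; map; foldr)
open import Data.List.Properties using (foldr-++; foldr-map)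
open import Data.Vec using ([]; _∷_; here)
open import Data.Vec.Properties using (≡-dec)
open import Data.Fin.Subset using (Subset; _⊆_; _∪_; _─_; ∣_∣; outside; inside)
open import Data.Fin.Subset.Properties
  using (_⊆?_; ⊆-refl; ⊆-trans; drop-∷-⊆; p⊆p∪q; q⊆p∪q; x∈p∪q⁻)
open import Data.Product using (_×_; _,_)
open import Data.Sum using ([_,_]′)
open import Function using (_∘_; case_of_)
open import Function.Bundles using (_⇔_; mk⇔)
open import Data.Empty using (⊥-elim)
open import Relation.Nullary.Decidable
  using (yes; no; does; isYes; isYes≗does; dec-true; does-⇔; _×-dec_)
open import Relation.Binary.PropositionalEquality as ≡ using (_≡_; refl; cong; cong₂)
open import Algebra.Bundles using (CommutativeRing)

-- Unlike isYes, does commutes with the map in ⊆? and ≡-dec, so these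
-- reduce one head at a time on cons cells.
_⊆ᵇ_ : ∀ {n} → Subset n → Subset n → Bool
p ⊆ᵇ q = does (p ⊆? q)

_≡ᵇ_ : ∀ {n} → Subset n → Subset n → Bool
p ≡ᵇ q = does (≡-dec Bool._≟_ p q)

⊆ᵇ⇒⊆ : ∀ {n} (p q : Subset n) → p ⊆ᵇ q ≡ true → p ⊆ q
⊆ᵇ⇒⊆ p q p⊆ᵇq with p ⊆? q
⊆ᵇ⇒⊆ p q _  | yes p⊆q = p⊆q
⊆ᵇ⇒⊆ p q () | no _

⊆⇒⊆ᵇ : ∀ {n} {p q : Subset n} → p ⊆ q → p ⊆ᵇ q ≡ true
⊆⇒⊆ᵇ {p = p} {q} = dec-true (p ⊆? q)

∪-least : ∀ {n} {p q r : Subset n} → p ⊆ r → q ⊆ r → p ∪ q ⊆ r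
∪-least {p = p} {q} p⊆r q⊆r = [ p⊆r , q⊆r ]′ ∘ x∈p∪q⁻ p q

∪-⊆ᵇ : ∀ {n} (p q r : Subset n) → (p ∪ q) ⊆ᵇ r ≡ p ⊆ᵇ r ∧ q ⊆ᵇ r
∪-⊆ᵇ p q r = does-⇔ ∪⊆⇔ ((p ∪ q) ⊆? r) ((p ⊆? r) ×-dec (q ⊆? r))
  where
  ∪⊆⇔ : p ∪ q ⊆ r ⇔ (p ⊆ r × q ⊆ r)
  ∪⊆⇔ = mk⇔ bounds least
    where
    bounds : p ∪ q ⊆ r → p ⊆ r × q ⊆ r
    bounds p∪q⊆r = ⊆-trans (p⊆p∪q q) p∪q⊆r , ⊆-trans (q⊆p∪q p q) p∪q⊆r
    least : p ⊆ r × q ⊆ r → p ∪ q ⊆ r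
    least (p⊆r , q⊆r) = ∪-least p⊆r q⊆r

q⊆p⇒∣p─q∣+∣q∣≡∣p∣ : ∀ {n} {p q : Subset n} → q ⊆ p → ∣ p ─ q ∣ ℕ.+ ∣ q ∣ ≡ ∣ p ∣
q⊆p⇒∣p─q∣+∣q∣≡∣p∣ {p = []}          {[]}          _   = refl
q⊆p⇒∣p─q∣+∣q∣≡∣p∣ {p = outside ∷ p} {outside ∷ q} q⊆p = q⊆p⇒∣p─q∣+∣q∣≡∣p∣ (drop-∷-⊆ q⊆p)
q⊆p⇒∣p─q∣+∣q∣≡∣p∣ {p = inside  ∷ p} {outside ∷ q} q⊆p =
  cong suc (q⊆p⇒∣p─q∣+∣q∣≡∣p∣ (drop-∷-⊆ q⊆p))
q⊆p⇒∣p─q∣+∣q∣≡∣p∣ {p = inside  ∷ p} {inside  ∷ q} q⊆p =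
  ≡.trans (+-suc _ _) (cong suc (q⊆p⇒∣p─q∣+∣q∣≡∣p∣ (drop-∷-⊆ q⊆p)))
q⊆p⇒∣p─q∣+∣q∣≡∣p∣ {p = outside ∷ p} {inside  ∷ q} q⊆p = case q⊆p here of λ ()

Convex : ∀ {n} → (Subset n → Bool) → Set
Convex F = ∀ {X T S} → X ⊆ T → T ⊆ S → F X ≡ true → F S ≡ true → F T ≡ true

inUp-mono : ∀ {n} (G : List (Subset n)) {X Y : Subset n} →
            X ⊆ Y → inUp G X ≡ true → inUp G Y ≡ true
inUp-mono []      _   ()
inUp-mono (T ∷ G) {X} {Y} X⊆Y X∈↑G with T ⊆? X | T ⊆? Y
... | _       | yes _   = refl
... | yes T⊆X | no T⊈Y = ⊥-elim (T⊈Y (⊆-trans T⊆X X⊆Y))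
... | no _    | no _    = inUp-mono G X⊆Y X∈↑G

inCD-convex : ∀ {n} (F₊ F₋ : List (Subset n)) → Convex (inCD F₊ F₋)
inCD-convex F₊ F₋ {X} {T} {S} X⊆T T⊆S X∈F S∈F with inUp F₊ X in X∈↑F₊ | inUp F₋ T in T∈↑F₋
... | true | false rewrite inUp-mono F₊ X⊆T X∈↑F₊ = refl
... | true | true  = case S∉F of λ ()
  where
  S∉F : true ≡ false
  S∉F = ≡.trans (≡.sym S∈F)
          (≡.trans (cong (λ b → inUp F₊ S ∧ not b) (inUp-mono F₋ T⊆S T∈↑F₋)) (∧-zeroʳ _))

module _ {c ℓ : Level} (R : CommutativeRing c ℓ) where
  open CommutativeRing R renaming (refl to ≈-refl)
  open Transforms R
  open import Algebra.Properties.Ring ring using (-‿distribˡ-*; -‿distribʳ-*)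
  open import Algebra.Properties.Group +-group using (⁻¹-involutive)
  open import Algebra.Properties.CommutativeSemigroup +-commutativeSemigroup using (interchange)
  open import Relation.Binary.Reasoning.Setoid setoid

  sgn-+ : ∀ a b → sgn (a ℕ.+ b) ≈ sgn a * sgn b
  sgn-+ zero    b = sym (*-identityˡ _)
  sgn-+ (suc a) b = trans (-‿cong (sgn-+ a b)) (-‿distribˡ-* (sgn a) (sgn b))

  sgn*sgn≈1 : ∀ k → sgn k * sgn k ≈ 1#
  sgn*sgn≈1 zero    = *-identityˡ 1#
  sgn*sgn≈1 (suc k) = begin
    - sgn k * - sgn k   ≈⟨ -‿distribˡ-* (sgn k) (- sgn k) ⟨
    - (sgn k * - sgn k) ≈⟨ -‿cong (-‿distribʳ-* (sgn k) (sgn k)) ⟨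
    - - (sgn k * sgn k) ≈⟨ ⁻¹-involutive _ ⟩
    sgn k * sgn k       ≈⟨ sgn*sgn≈1 k ⟩
    1#                  ∎

  sgn*[sgn*x]≈x : ∀ k x → sgn k * (sgn k * x) ≈ x
  sgn*[sgn*x]≈x k x = trans (sym (*-assoc _ _ _)) (trans (*-congʳ (sgn*sgn≈1 k)) (*-identityˡ x))

  sgn∣p∣*sgn∣q∣≈sgn∣p─q∣ : ∀ {n} {p q : Subset n} → q ⊆ p → sgn ∣ p ∣ * sgn ∣ q ∣ ≈ sgn ∣ p ─ q ∣
  sgn∣p∣*sgn∣q∣≈sgn∣p─q∣ {p = p} {q} q⊆p = begin
    sgn ∣ p ∣ * sgn ∣ q ∣                       ≡⟨ cong (λ k → sgn k * sgn ∣ q ∣) (q⊆p⇒∣p─q∣+∣q∣≡∣p∣ q⊆p) ⟨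
    sgn (∣ p ─ q ∣ ℕ.+ ∣ q ∣) * sgn ∣ q ∣       ≈⟨ *-congʳ (sgn-+ ∣ p ─ q ∣ ∣ q ∣) ⟩
    sgn ∣ p ─ q ∣ * sgn ∣ q ∣ * sgn ∣ q ∣       ≈⟨ *-assoc _ _ _ ⟩
    sgn ∣ p ─ q ∣ * (sgn ∣ q ∣ * sgn ∣ q ∣)     ≈⟨ *-congˡ (sgn*sgn≈1 ∣ q ∣) ⟩
    sgn ∣ p ─ q ∣ * 1#                          ≈⟨ *-identityʳ _ ⟩
    sgn ∣ p ─ q ∣                               ∎

  infixr 9 [_]_
  [_]_ : Bool → Carrier → Carrier
  [ b ] x = if b then x else 0#

  []-cong : ∀ b {x y} → x ≈ y → [ b ] x ≈ [ b ] y
  []-cong true  x≈y = x≈y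
  []-cong false _   = ≈-refl

  []-when : ∀ b {x y} → (b ≡ true → x ≈ y) → [ b ] x ≈ [ b ] y
  []-when true  x≈y = x≈y refl
  []-when false _   = ≈-refl

  []-zero : ∀ b → [ b ] 0# ≡ 0#
  []-zero true  = refl
  []-zero false = refl

  []-∧ : ∀ a b x → [ a ∧ b ] x ≡ [ a ] [ b ] x
  []-∧ true  b x = refl
  []-∧ false b x = refl

  []-∧-false : ∀ a x → [ a ∧ false ] x ≡ 0#
  []-∧-false a x = cong ([_] x) (∧-zeroʳ a)

  []-comm : ∀ a b x → [ a ] [ b ] x ≡ [ b ] [ a ] x
  []-comm true  b     x = refl
  []-comm false true  x = refl
  []-comm false false x = refl

  []-rotate : ∀ a b c d x → [ a ] [ b ] [ c ] [ d ] x ≡ [ d ] [ a ] [ b ] [ c ] x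
  []-rotate a b c true  x = refl
  []-rotate a b c false x =
    ≡.trans (cong [ a ]_ (≡.trans (cong [ b ]_ ([]-zero c)) ([]-zero b))) ([]-zero a)

  *-[] : ∀ a b x → a * [ b ] x ≈ [ b ] (a * x)
  *-[] a true  x = ≈-refl
  *-[] a false x = zeroʳ a

  []-* : ∀ b x a → [ b ] x * a ≈ [ b ] (x * a)
  []-* true  x a = ≈-refl
  []-* false x a = zeroˡ a

  []-*-[] : ∀ a b x y → [ a ] x * [ b ] y ≈ [ a ] [ b ] (x * y)
  []-*-[] true  b x y = *-[] x b y
  []-*-[] false b x y = zeroˡ _

  []-neg-cancel : ∀ b x → [ b ] (- x) + [ b ] x ≈ 0#
  []-neg-cancel true  x = -‿inverseˡ x
  []-neg-cancel false x = +-identityˡ 0#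

  ∑ : ∀ {n} → (Subset n → Carrier) → Carrier
  ∑ {zero}  f = f []
  ∑ {suc n} f = ∑ (f ∘ (outside ∷_)) + ∑ (f ∘ (inside ∷_))

  ∑-cong : ∀ {n} {f g : Subset n → Carrier} → (∀ T → f T ≈ g T) → ∑ f ≈ ∑ g
  ∑-cong {zero}  f≈g = f≈g []
  ∑-cong {suc n} f≈g = +-cong (∑-cong (f≈g ∘ (outside ∷_))) (∑-cong (f≈g ∘ (inside ∷_)))

  ∑-vanish : ∀ {n} {f : Subset n → Carrier} → (∀ T → f T ≈ 0#) → ∑ f ≈ 0#
  ∑-vanish {zero}  f≈0 = f≈0 []
  ∑-vanish {suc n} f≈0 =
    trans (+-cong (∑-vanish {n} (f≈0 ∘ (outside ∷_))) (∑-vanish {n} (f≈0 ∘ (inside ∷_))))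
          (+-identityˡ 0#)

  ∑-+ : ∀ {n} (f g : Subset n → Carrier) → ∑ (λ T → f T + g T) ≈ ∑ f + ∑ g
  ∑-+ {zero}  f g = ≈-refl
  ∑-+ {suc n} f g = trans (+-cong (∑-+ (f ∘ (outside ∷_)) (g ∘ (outside ∷_)))
                                  (∑-+ (f ∘ (inside ∷_)) (g ∘ (inside ∷_))))
                          (interchange _ _ _ _)

  *-∑ : ∀ {n} a (f : Subset n → Carrier) → a * ∑ f ≈ ∑ (λ T → a * f T)
  *-∑ {zero}  a f = ≈-refl
  *-∑ {suc n} a f = trans (distribˡ a _ _) (+-cong (*-∑ a (f ∘ (outside ∷_))) (*-∑ a (f ∘ (inside ∷_))))

  ∑-* : ∀ {n} a (f : Subset n → Carrier) → ∑ f * a ≈ ∑ (λ T → f T * a)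
  ∑-* {zero}  a f = ≈-refl
  ∑-* {suc n} a f = trans (distribʳ a _ _) (+-cong (∑-* a (f ∘ (outside ∷_))) (∑-* a (f ∘ (inside ∷_))))

  []-∑ : ∀ {n} b (f : Subset n → Carrier) → [ b ] ∑ f ≈ ∑ (λ T → [ b ] f T)
  []-∑     true  f = ≈-refl
  []-∑ {n} false f = sym (∑-vanish {n} (λ _ → ≈-refl))

  ∑-comm : ∀ {m n} (f : Subset m → Subset n → Carrier) →
           ∑ (λ T → ∑ (f T)) ≈ ∑ (λ U → ∑ (λ T → f T U))
  ∑-comm {zero}  f = ≈-refl
  ∑-comm {suc m} f = trans (+-cong (∑-comm (f ∘ (outside ∷_))) (∑-comm (f ∘ (inside ∷_))))
                           (sym (∑-+ (λ U → ∑ (λ T → f (outside ∷ T) U))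
                                     (λ U → ∑ (λ T → f (inside ∷ T) U))))

  ∑-δ : ∀ {n} (V : Subset n) (f : Subset n → Carrier) → ∑ (λ U → [ V ≡ᵇ U ] f U) ≈ f V
  ∑-δ         []            f = ≈-refl
  ∑-δ {suc n} (outside ∷ V) f = trans (+-cong (∑-δ V _) (∑-vanish {n} (λ _ → ≈-refl))) (+-identityʳ _)
  ∑-δ {suc n} (inside  ∷ V) f = trans (+-cong (∑-vanish {n} (λ _ → ≈-refl)) (∑-δ V _)) (+-identityˡ _)

  ∑-interval-sgn : ∀ {n} (X S : Subset n) →
                   ∑ (λ T → [ X ⊆ᵇ T ∧ T ⊆ᵇ S ] sgn ∣ S ─ T ∣) ≈ [ S ≡ᵇ X ] 1#
  ∑-interval-sgn         []            []            = ≈-refl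
  ∑-interval-sgn {suc n} (outside ∷ X) (outside ∷ S) =
    trans (+-cong (∑-interval-sgn X S) (∑-vanish {n} (λ T → reflexive ([]-∧-false (X ⊆ᵇ T) _))))
          (+-identityʳ _)
  ∑-interval-sgn {suc n} (outside ∷ X) (inside  ∷ S) =
    trans (sym (∑-+ {n} _ _)) (∑-vanish {n} (λ T → []-neg-cancel (X ⊆ᵇ T ∧ T ⊆ᵇ S) _))
  ∑-interval-sgn {suc n} (inside  ∷ X) (outside ∷ S) =
    trans (+-cong (∑-vanish {n} (λ _ → ≈-refl)) (∑-vanish {n} (λ T → reflexive ([]-∧-false (X ⊆ᵇ T) _))))
          (+-identityˡ 0#)
  ∑-interval-sgn {suc n} (inside  ∷ X) (inside  ∷ S) =
    trans (+-cong (∑-vanish {n} (λ _ → ≈-refl)) (∑-interval-sgn X S)) (+-identityˡ _)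

  foldr-if≈∑ : ∀ {n} (p : Subset n → Bool) (f : Subset n → Carrier) z →
               foldr (λ T acc → if p T then f T + acc else acc) z (allSubsets n)
               ≈ ∑ (λ T → [ p T ] f T) + z
  foldr-if≈∑ {zero} p f z with p []
  ... | true  = ≈-refl
  ... | false = sym (+-identityˡ z)
  foldr-if≈∑ {suc n} p f z = begin
    foldr step z (map (outside ∷_) L ++ map (inside ∷_) L)
      ≡⟨ ≡.trans (foldr-++ step z (map (outside ∷_) L) _) (foldr-map step (outside ∷_) _ L) ⟩
    foldr (step ∘ (outside ∷_)) (foldr step z (map (inside ∷_) L)) L
      ≡⟨ cong (λ z′ → foldr (step ∘ (outside ∷_)) z′ L) (foldr-map step (inside ∷_) z L) ⟩
    foldr (step ∘ (outside ∷_)) (foldr (step ∘ (inside ∷_)) z L) L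
      ≈⟨ foldr-if≈∑ (p ∘ (outside ∷_)) (f ∘ (outside ∷_)) _ ⟩
    ∑ (guarded ∘ (outside ∷_)) + foldr (step ∘ (inside ∷_)) z L
      ≈⟨ +-congˡ (foldr-if≈∑ (p ∘ (inside ∷_)) (f ∘ (inside ∷_)) z) ⟩
    ∑ (guarded ∘ (outside ∷_)) + (∑ (guarded ∘ (inside ∷_)) + z)
      ≈⟨ +-assoc _ _ _ ⟨
    ∑ guarded + z ∎
    where
    L : List (Subset n)
    L = allSubsets n
    step : Subset (suc n) → Carrier → Carrier
    step T acc = if p T then f T + acc else acc
    guarded : Subset (suc n) → Carrier
    guarded T = [ p T ] f T

  sumWhere≈∑ : ∀ {n} (p : Subset n → Bool) (f : Subset n → Carrier) →
               sumWhere p f ≈ ∑ (λ T → [ p T ] f T)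
  sumWhere≈∑ p f = trans (foldr-if≈∑ p f 0#) (+-identityʳ _)

  module _ {n : ℕ} (F : Subset n → Bool) where
    open OnFamily F

    _⊆ᶠ_ : Subset n → Subset n → Bool
    T ⊆ᶠ S = F T ∧ T ⊆ᵇ S

    sumWhere-⊆ᶠ≈∑ : ∀ S (g : Table) → sumWhere (λ T → F T ∧ isYes (T ⊆? S)) g ≈ ∑ (λ T → [ T ⊆ᶠ S ] g T)
    sumWhere-⊆ᶠ≈∑ S g = trans (sumWhere≈∑ (λ T → F T ∧ isYes (T ⊆? S)) g)
      (∑-cong {n} (λ T → reflexive (cong (λ b → [ F T ∧ b ] g T) (isYes≗does (T ⊆? S)))))

    ζ≈∑ : ∀ A S → ζ A S ≈ ∑ (λ T → [ T ⊆ᶠ S ] A T)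
    ζ≈∑ A S = sumWhere-⊆ᶠ≈∑ S A

    μ≈∑ : ∀ A S → μ A S ≈ ∑ (λ T → [ T ⊆ᶠ S ] (sgn ∣ S ─ T ∣ * A T))
    μ≈∑ A S = sumWhere-⊆ᶠ≈∑ S (λ T → sgn ∣ S ─ T ∣ * A T)

    cover≈∑ : ∀ A B U →
              cover A B U ≈ ∑ (λ T₁ → ∑ (λ T₂ → [ F T₁ ] [ F T₂ ] [ (T₁ ∪ T₂) ≡ᵇ U ] (A T₁ * B T₂)))
    cover≈∑ A B U = trans (sumWhere≈∑ F partners) (∑-cong {n} λ T₁ →
      trans ([]-cong (F T₁) (sumWhere≈∑ (λ T₂ → F T₂ ∧ subsetEq (T₁ ∪ T₂) U) (λ T₂ → A T₁ * B T₂)))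
            (trans ([]-∑ {n} (F T₁) _) (∑-cong {n} λ T₂ → reflexive (cong [ F T₁ ]_ (unfold-guard T₁ T₂)))))
      where
      partners : Table
      partners T₁ = sumWhere (λ T₂ → F T₂ ∧ subsetEq (T₁ ∪ T₂) U) (λ T₂ → A T₁ * B T₂)
      unfold-guard : ∀ T₁ T₂ → [ F T₂ ∧ subsetEq (T₁ ∪ T₂) U ] (A T₁ * B T₂)
                               ≡ [ F T₂ ] [ (T₁ ∪ T₂) ≡ᵇ U ] (A T₁ * B T₂)
      unfold-guard T₁ T₂ = ≡.trans
        (cong (λ b → [ F T₂ ∧ b ] (A T₁ * B T₂)) (isYes≗does (≡-dec Bool._≟_ (T₁ ∪ T₂) U)))
        ([]-∧ (F T₂) _ _)

    ζ-cong : ∀ {A B} → (∀ T → A T ≈ B T) → ∀ S → ζ A S ≈ ζ B S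
    ζ-cong {A} {B} A≈B S =
      trans (ζ≈∑ A S) (trans (∑-cong {n} (λ T → []-cong (T ⊆ᶠ S) (A≈B T))) (sym (ζ≈∑ B S)))

    σσ≈id : ∀ A S → σ (σ A) S ≈ A S
    σσ≈id A S = sgn*[sgn*x]≈x ∣ S ∣ (A S)

    σζσ≈μ : ∀ A S → σ (ζ (σ A)) S ≈ μ A S
    σζσ≈μ A S = begin
      sgn ∣ S ∣ * ζ (σ A) S
        ≈⟨ *-congˡ (ζ≈∑ (σ A) S) ⟩
      sgn ∣ S ∣ * ∑ (λ T → [ T ⊆ᶠ S ] (sgn ∣ T ∣ * A T))
        ≈⟨ *-∑ {n} _ _ ⟩
      ∑ (λ T → sgn ∣ S ∣ * [ T ⊆ᶠ S ] (sgn ∣ T ∣ * A T))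
        ≈⟨ ∑-cong {n} (λ T → trans (*-[] _ (T ⊆ᶠ S) _) ([]-when (T ⊆ᶠ S) (signs T))) ⟩
      ∑ (λ T → [ T ⊆ᶠ S ] (sgn ∣ S ─ T ∣ * A T))
        ≈⟨ μ≈∑ A S ⟨
      μ A S ∎
      where
      signs : ∀ T → T ⊆ᶠ S ≡ true → sgn ∣ S ∣ * (sgn ∣ T ∣ * A T) ≈ sgn ∣ S ─ T ∣ * A T
      signs T T⊆ᶠS = trans (sym (*-assoc _ _ _))
        (*-congʳ (sgn∣p∣*sgn∣q∣≈sgn∣p─q∣ (⊆ᵇ⇒⊆ T S (∧-conicalʳ (F T) _ T⊆ᶠS))))

    σμσ≈ζ : ∀ A S → σ (μ (σ A)) S ≈ ζ A S
    σμσ≈ζ A S = begin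
      sgn ∣ S ∣ * μ (σ A) S      ≈⟨ *-congˡ (σζσ≈μ (σ A) S) ⟨
      σ (σ (ζ (σ (σ A)))) S     ≈⟨ σσ≈id (ζ (σ (σ A))) S ⟩
      ζ (σ (σ A)) S             ≈⟨ ζ-cong (σσ≈id A) S ⟩
      ζ A S                     ∎

    module _ (convex : Convex F) {S : Subset n} (S∈F : F S ≡ true) where

      interval-guard : ∀ X T y → [ F T ∧ T ⊆ᵇ S ] [ F X ∧ X ⊆ᵇ T ] y
                                 ≡ [ F X ∧ X ⊆ᵇ S ] [ X ⊆ᵇ T ∧ T ⊆ᵇ S ] y
      interval-guard X T y with F X in X∈F | X ⊆ᵇ T in X⊆ᵇT | T ⊆ᵇ S in T⊆ᵇS
      ... | false | _     | t⊆s   = []-zero (F T ∧ t⊆s)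
      ... | true  | false | t⊆s   = ≡.trans ([]-zero (F T ∧ t⊆s)) (≡.sym ([]-zero (X ⊆ᵇ S)))
      ... | true  | true  | false = ≡.trans ([]-∧-false (F T) y) (≡.sym ([]-zero (X ⊆ᵇ S)))
      ... | true  | true  | true
        rewrite convex (⊆ᵇ⇒⊆ X T X⊆ᵇT) (⊆ᵇ⇒⊆ T S T⊆ᵇS) X∈F S∈F =
          cong ([_] y) (≡.sym (⊆⇒⊆ᵇ (⊆-trans (⊆ᵇ⇒⊆ X T X⊆ᵇT) (⊆ᵇ⇒⊆ T S T⊆ᵇS))))

      μζ≈id : ∀ A → μ (ζ A) S ≈ A S
      μζ≈id A = begin
        μ (ζ A) S
          ≈⟨ μ≈∑ (ζ A) S ⟩
        ∑ (λ T → [ T ⊆ᶠ S ] (sgn ∣ S ─ T ∣ * ζ A T))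
          ≈⟨ ∑-cong {n} (λ T → []-cong (T ⊆ᶠ S) (trans (*-congˡ (ζ≈∑ A T)) (*-∑ {n} _ _))) ⟩
        ∑ (λ T → [ T ⊆ᶠ S ] ∑ (λ X → sgn ∣ S ─ T ∣ * [ X ⊆ᶠ T ] A X))
          ≈⟨ ∑-cong {n} (λ T → trans ([]-∑ {n} (T ⊆ᶠ S) _)
                                     (∑-cong {n} λ X → []-cong (T ⊆ᶠ S) (*-[] _ (X ⊆ᶠ T) _))) ⟩
        ∑ (λ T → ∑ (λ X → [ T ⊆ᶠ S ] [ X ⊆ᶠ T ] (sgn ∣ S ─ T ∣ * A X)))
          ≈⟨ ∑-comm {n} {n} _ ⟩
        ∑ (λ X → ∑ (λ T → [ T ⊆ᶠ S ] [ X ⊆ᶠ T ] (sgn ∣ S ─ T ∣ * A X)))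
          ≈⟨ ∑-cong {n} (λ X → ∑-cong {n} λ T → reflexive (interval-guard X T _)) ⟩
        ∑ (λ X → ∑ (λ T → [ X ⊆ᶠ S ] [ X ⊆ᵇ T ∧ T ⊆ᵇ S ] (sgn ∣ S ─ T ∣ * A X)))
          ≈⟨ ∑-cong {n} factor ⟨
        ∑ (λ X → [ X ⊆ᶠ S ] (∑ (λ T → [ X ⊆ᵇ T ∧ T ⊆ᵇ S ] sgn ∣ S ─ T ∣) * A X))
          ≈⟨ ∑-cong {n} (λ X → []-cong (X ⊆ᶠ S) (*-congʳ (∑-interval-sgn X S))) ⟩
        ∑ (λ X → [ X ⊆ᶠ S ] ([ S ≡ᵇ X ] 1# * A X))
          ≈⟨ ∑-cong {n} δ-first ⟩
        ∑ (λ X → [ S ≡ᵇ X ] [ X ⊆ᶠ S ] A X)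
          ≈⟨ ∑-δ S (λ X → [ X ⊆ᶠ S ] A X) ⟩
        [ S ⊆ᶠ S ] A S
          ≡⟨ cong₂ (λ a b → [ a ∧ b ] A S) S∈F (⊆⇒⊆ᵇ {p = S} ⊆-refl) ⟩
        A S ∎
        where
        factor : ∀ X → [ X ⊆ᶠ S ] (∑ (λ T → [ X ⊆ᵇ T ∧ T ⊆ᵇ S ] sgn ∣ S ─ T ∣) * A X)
                       ≈ ∑ (λ T → [ X ⊆ᶠ S ] [ X ⊆ᵇ T ∧ T ⊆ᵇ S ] (sgn ∣ S ─ T ∣ * A X))
        factor X = trans ([]-cong (X ⊆ᶠ S) (trans (∑-* {n} _ _)
                                               (∑-cong {n} λ T → []-* (X ⊆ᵇ T ∧ T ⊆ᵇ S) _ _)))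
                         ([]-∑ {n} (X ⊆ᶠ S) _)
        δ-first : ∀ X → [ X ⊆ᶠ S ] ([ S ≡ᵇ X ] 1# * A X) ≈ [ S ≡ᵇ X ] [ X ⊆ᶠ S ] A X
        δ-first X = trans ([]-cong (X ⊆ᶠ S) (trans ([]-* (S ≡ᵇ X) 1# (A X))
                                                   ([]-cong (S ≡ᵇ X) (*-identityˡ (A X)))))
                          (reflexive ([]-comm (X ⊆ᶠ S) (S ≡ᵇ X) (A X)))

      ζμ≈id : ∀ A → ζ (μ A) S ≈ A S
      ζμ≈id A = begin
        ζ (μ A) S                    ≈⟨ ζ-cong (σζσ≈μ A) S ⟨
        ζ (σ (ζ (σ A))) S            ≈⟨ σσ≈id (ζ (σ (ζ (σ A)))) S ⟨
        σ (σ (ζ (σ (ζ (σ A))))) S    ≈⟨ *-congˡ (σζσ≈μ (ζ (σ A)) S) ⟩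
        σ (μ (ζ (σ A))) S            ≈⟨ *-congˡ (μζ≈id (σ A)) ⟩
        σ (σ A) S                    ≈⟨ σσ≈id A S ⟩
        A S                          ∎

      ∪-guard : ∀ T₁ T₂ y → [ F (T₁ ∪ T₂) ∧ (T₁ ∪ T₂) ⊆ᵇ S ] [ F T₁ ] [ F T₂ ] y
                            ≡ [ F T₁ ∧ T₁ ⊆ᵇ S ] [ F T₂ ∧ T₂ ⊆ᵇ S ] y
      ∪-guard T₁ T₂ y rewrite ∪-⊆ᵇ T₁ T₂ S
        with F T₁ in T₁∈F | F T₂ | T₁ ⊆ᵇ S in T₁⊆ᵇS | T₂ ⊆ᵇ S in T₂⊆ᵇS
      ... | false | _     | t₁⊆s  | t₂⊆s  = []-zero (F (T₁ ∪ T₂) ∧ t₁⊆s ∧ t₂⊆s)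
      ... | true  | false | t₁⊆s  | t₂⊆s  =
        ≡.trans ([]-zero (F (T₁ ∪ T₂) ∧ t₁⊆s ∧ t₂⊆s)) (≡.sym ([]-zero t₁⊆s))
      ... | true  | true  | false | _     = []-∧-false (F (T₁ ∪ T₂)) y
      ... | true  | true  | true  | false = []-∧-false (F (T₁ ∪ T₂)) y
      ... | true  | true  | true  | true
        rewrite convex (p⊆p∪q T₂) (∪-least (⊆ᵇ⇒⊆ T₁ S T₁⊆ᵇS) (⊆ᵇ⇒⊆ T₂ S T₂⊆ᵇS)) T₁∈F S∈F = refl

      ζ-cover : ∀ A B → ζ (cover A B) S ≈ ζ A S * ζ B S
      ζ-cover A B = begin
        ζ (cover A B) S
          ≈⟨ ζ≈∑ (cover A B) S ⟩
        ∑ (λ U → [ U ⊆ᶠ S ] cover A B U)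
          ≈⟨ ∑-cong {n} (λ U → trans ([]-cong (U ⊆ᶠ S) (cover≈∑ A B U))
                                 (trans ([]-∑ {n} (U ⊆ᶠ S) _) (∑-cong {n} λ T₁ → []-∑ {n} (U ⊆ᶠ S) _))) ⟩
        ∑ (λ U → ∑ (λ T₁ → ∑ (λ T₂ → [ U ⊆ᶠ S ] [ F T₁ ] [ F T₂ ] [ (T₁ ∪ T₂) ≡ᵇ U ] y T₁ T₂)))
          ≈⟨ trans (∑-comm {n} {n} _) (∑-cong {n} λ T₁ → ∑-comm {n} {n} _) ⟩
        ∑ (λ T₁ → ∑ (λ T₂ → ∑ (λ U → [ U ⊆ᶠ S ] [ F T₁ ] [ F T₂ ] [ (T₁ ∪ T₂) ≡ᵇ U ] y T₁ T₂)))
          ≈⟨ ∑-cong {n} (λ T₁ → ∑-cong {n} λ T₂ → collapse T₁ T₂) ⟩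
        ∑ (λ T₁ → ∑ (λ T₂ → [ T₁ ⊆ᶠ S ] A T₁ * [ T₂ ⊆ᶠ S ] B T₂))
          ≈⟨ trans (∑-cong {n} λ T₁ → sym (*-∑ {n} _ _)) (sym (∑-* {n} _ _)) ⟩
        ∑ (λ T₁ → [ T₁ ⊆ᶠ S ] A T₁) * ∑ (λ T₂ → [ T₂ ⊆ᶠ S ] B T₂)
          ≈⟨ *-cong (ζ≈∑ A S) (ζ≈∑ B S) ⟨
        ζ A S * ζ B S ∎
        where
        y : Subset n → Subset n → Carrier
        y T₁ T₂ = A T₁ * B T₂
        collapse : ∀ T₁ T₂ → ∑ (λ U → [ U ⊆ᶠ S ] [ F T₁ ] [ F T₂ ] [ (T₁ ∪ T₂) ≡ᵇ U ] y T₁ T₂)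
                             ≈ [ T₁ ⊆ᶠ S ] A T₁ * [ T₂ ⊆ᶠ S ] B T₂
        collapse T₁ T₂ = begin
          ∑ (λ U → [ U ⊆ᶠ S ] [ F T₁ ] [ F T₂ ] [ (T₁ ∪ T₂) ≡ᵇ U ] y T₁ T₂)
            ≈⟨ ∑-cong {n} (λ U → reflexive ([]-rotate (U ⊆ᶠ S) (F T₁) (F T₂) ((T₁ ∪ T₂) ≡ᵇ U) _)) ⟩
          ∑ (λ U → [ (T₁ ∪ T₂) ≡ᵇ U ] [ U ⊆ᶠ S ] [ F T₁ ] [ F T₂ ] y T₁ T₂)
            ≈⟨ ∑-δ (T₁ ∪ T₂) (λ U → [ U ⊆ᶠ S ] [ F T₁ ] [ F T₂ ] y T₁ T₂) ⟩
          [ (T₁ ∪ T₂) ⊆ᶠ S ] [ F T₁ ] [ F T₂ ] y T₁ T₂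
            ≡⟨ ∪-guard T₁ T₂ _ ⟩
          [ T₁ ⊆ᶠ S ] [ T₂ ⊆ᶠ S ] y T₁ T₂
            ≈⟨ []-*-[] (T₁ ⊆ᶠ S) (T₂ ⊆ᶠ S) (A T₁) (B T₂) ⟨
          [ T₁ ⊆ᶠ S ] A T₁ * [ T₂ ⊆ᶠ S ] B T₂ ∎

lemma46 : {c ℓ : Level} (n : ℕ) (F₊ F₋ : List (Subset n)) (R : CommutativeRing c ℓ) →
    let open CommutativeRing R
        open Transforms R
        open OnFamily (inCD F₊ F₋)
    in (A B : Subset n → Carrier) (S : Subset n) → inCD F₊ F₋ S ≡ true →
       (σ (ζ (σ A)) S ≈ μ A S) × (σ (μ (σ A)) S ≈ ζ A S)
       × (μ (ζ A) S ≈ A S) × (ζ (μ A) S ≈ A S)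
       × (ζ (cover A B) S ≈ pointwise (ζ A) (ζ B) S)
lemma46 n F₊ F₋ R A B S S∈F =
  σζσ≈μ R F A S , σμσ≈ζ R F A S , μζ≈id R F convex S∈F A , ζμ≈id R F convex S∈F A ,
  ζ-cover R F convex S∈F A B
  where
  F : Subset n → Bool
  F = inCD F₊ F₋
  convex : Convex F
  convex = inCD-convex F₊ F₋
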